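{- Suppose that (1) the limit $f_\infty(1)=\lim_{n\to\infty}\frac{|s_1\cdots s_n|_1}{n}$ exists; (2) there is a strictly increasing sequence of positive integers $k_1<k_2<k_3<\cdots$ such that for every $n$ there exists a $k_n$-normal prefix of $S$ (so in particular the $k_n$-minimal prefix $p_{k_n}$ exists); (3) for every $\varepsilon>0$ there is a positive integer $L_\varepsilon$ such that for every $n$, every positive integer $m$ with $|b^n_m|>L_\varepsilon$, and every prefix $c^n_m$ of $b^n_m$ with $|c^n_m|\ge L_\varepsilon$, one has $|f_{b^n_m}(1)-f_{c^n_m}(1)|<\varepsilon$, where $b^n_m$ ($m=1,2,\dots$) are the blocks generated by the $k_n$-minimal prefix $p_{k_n}$. Then $f_\infty(1)=\frac12$.
   Context: Words are over the alphabet $\{1,2\}$; $|v|$ is the length of $v$ and $|v|_x$ the number of occurrences of the letter $x$ in $v$; for nonempty $v$, $f_v(x)=|v|_x/|v|$. For a finite or infinite word $v=a_1a_2\cdots$, its integral $v^{ -1}$ is obtained by replacing each letter $a_i$ by $a_i$ copies of the letter $1$ if $i$ is odd and by $a_i$ copies of the letter $2$ if $i$ is even. Set $v^0=v$, $v^{ -k}=(v^{ -(k-1)})^{ -1}$. The Kolakoski sequence $S=s_1s_2\cdots=1221121221\cdots$ is the unique infinite word over $\{1,2\}$ with $S^{ -1}=S$; if $w$ is a prefix of $S$ then so is $w^{ -k}$ for all $k\ge0$. A prefix $w$ of $S$ is $k$-regular if $|w^{ -h}|$ is even for all $0\le h\le k$, and $k$-normal if it is $k$-regular but not $(k+1)$-regular.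 The $k$-minimal prefix is the shortest $k$-normal prefix of $S$ (if any exists). For a prefix $w$ of $S$ with $|w|>1$ and each positive integer $k$, the $k$-th block generated by $w$ is the unique word $b_k$ with $w^{ -k+1}b_k=w^{ -k}$; thus $S=wb_1b_2b_3\cdots$. -}

module Defs where

open import Data.Nat using (ℕ; zero; suc; _+_; _∸_; _≤_; _<_)
open import Data.Nat.Divisibility using (_∣_)
open import Data.Bool using (Bool; true; false; not; if_then_else_)
open import Data.List using (List; []; _∷_; _++_; replicate; length; take; drop; filter)
open import Data.Integer using (+_)
open import Data.Product using (_×_)
open import Relation.Nullary using (¬_)
open import Relation.Binary.PropositionalEquality using (_≡_)
open import Data.Rational.Unnormalised using (ℚᵘ; mkℚᵘ)
open import Data.Nat using (_≟_)

-- Words over {1,2} are lists of naturals (letters 1 and 2).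
Word : Set
Word = List ℕ

-- integral v^{-1}: the i-th letter a_i becomes a_i copies of 1 (i odd) or 2 (i even).
integralFrom : Bool → Word → Word
integralFrom odd [] = []
integralFrom odd (a ∷ v) = replicate a (if odd then 1 else 2) ++ integralFrom (not odd) v

integral : Word → Word
integral = integralFrom true

integralIter : ℕ → Word → Word
integralIter zero w = w
integralIter (suc k) w = integral (integralIter k w)

-- The Kolakoski sequence S: the words (122)^{-k} are prefixes of S of length ≥ k+3,
-- and the prefix of S of length n is the length-n prefix of (122)^{-n}.
Sprefix : ℕ → Word
Sprefix n = take n (integralIter n (1 ∷ 2 ∷ 2 ∷ []))

count1 : Word → ℕ
count1 v = length (filter (λ x → x ≟ 1) v)

-- f_v(1) = |v|_1 / |v|  (meaningful for nonempty v; mkℚᵘ p d denotes p/(d+1))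
freq1 : Word → ℚᵘ
freq1 v = mkℚᵘ (+ count1 v) (length v ∸ 1)

Regular : ℕ → Word → Set
Regular k w = ∀ h → h ≤ k → 2 ∣ length (integralIter h w)

Normal : ℕ → Word → Set
Normal k w = Regular k w × ¬ Regular (suc k) w

IsMinimal : ℕ → ℕ → Set
IsMinimal k n = Normal k (Sprefix n) × (∀ m → m < n → ¬ Normal k (Sprefix m))

-- the m-th block (m ≥ 1) generated by w: w^{-m+1} b_m = w^{-m}
block : Word → ℕ → Word
block w zero = []
block w (suc m) = drop (length (integralIter m w)) (integralIter (suc m) w)

-- Let w be a k-normal prefix of S (k ≥ 1) with blocks b_1, b_2, …. As |w^{-h}| is even for h ≤ k,
-- each b_{h+2} is the integral of b_{h+1}; since S is its own integral, b_{k+2} then begins with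
-- s_1⋯s_{k+1}. As |w^{-(k+1)}| is odd, B = b_{k+3} is that integral begun with 2s instead of 1s, so B
-- begins with s_1⋯s_{k+1} with the letters 1 and 2 exchanged. Both w^{-(k+2)} and w^{-(k+3)} = w^{-(k+2)} B
-- are prefixes of S, and |w^{-(k+2)}| ≤ 4|B|; so when f_∞(1) exists, f_B(1) is close to it, and by (3)
-- so is 1 − f(s_1⋯s_{k+1}), the frequency of 1 in the exchanged prefix. Letting k grow, f_∞(1) = 1 − f_∞(1).
module Submission where

open import Defs

module KolakoskiWords where

  open import Data.Nat using (ℕ; zero; suc; _+_; _*_; _≤_; _<_; _≤′_; ≤′-refl; ≤′-step; z≤n; s≤s; s≤s⁻¹; _≟_)
  open import Data.Nat.Properties
  open import Data.Nat.Divisibility using (_∣_; divides; ∣m+n∣m⇒∣n; ∣⇒≤)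
  open import Data.Nat.ListAction using (sum)
  open import Data.Nat.Solver using (module +-*-Solver)
  open import Data.Bool using (Bool; true; false; not; if_then_else_)
  open import Data.Bool.Properties using (not-involutive)
  open import Data.List using ([]; _∷_; _++_; replicate; length; take; drop; filter; map)
  open import Data.List.Properties using (++-assoc; ++-identityʳ; length-++; length-replicate; length-take; length-map; length-++-≤ˡ; length-++-≤ʳ; filter-++; map-++; map-replicate; take++drop≡id; ∷-injective)
  open import Data.Product using (_×_; ∃; _,_; proj₁; proj₂)
  open import Data.Sum using (_⊎_; inj₁; inj₂)
  open import Data.Empty using (⊥-elim)
  open import Relation.Nullary using (¬_)
  open import Relation.Binary.PropositionalEquality

  data Over12 : Word → Set where
    [] : Over12 []
    one∷_ : ∀ {v} → Over12 v → Over12 (1 ∷ v)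
    two∷_ : ∀ {v} → Over12 v → Over12 (2 ∷ v)

  count2 : Word → ℕ
  count2 v = length (filter (λ x → x ≟ 2) v)

  count1-++ : ∀ u v → count1 (u ++ v) ≡ count1 u + count1 v
  count1-++ u v = trans (cong length (filter-++ (λ x → x ≟ 1) u v)) (length-++ (filter (λ x → x ≟ 1) u))

  count2-++ : ∀ u v → count2 (u ++ v) ≡ count2 u + count2 v
  count2-++ u v = trans (cong length (filter-++ (λ x → x ≟ 2) u v)) (length-++ (filter (λ x → x ≟ 2) u))

  Over12-++ˡ : ∀ u {v} → Over12 (u ++ v) → Over12 u
  Over12-++ˡ [] _ = []
  Over12-++ˡ (1 ∷ u) (one∷ uv) = one∷ Over12-++ˡ u uv
  Over12-++ˡ (2 ∷ u) (two∷ uv) = two∷ Over12-++ˡ u uv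

  Over12-++ʳ : ∀ u {v} → Over12 (u ++ v) → Over12 v
  Over12-++ʳ [] uv = uv
  Over12-++ʳ (1 ∷ u) (one∷ uv) = Over12-++ʳ u uv
  Over12-++ʳ (2 ∷ u) (two∷ uv) = Over12-++ʳ u uv

  length≡count1+count2 : ∀ {v} → Over12 v → length v ≡ count1 v + count2 v
  length≡count1+count2 [] = refl
  length≡count1+count2 (one∷ v) = cong suc (length≡count1+count2 v)
  length≡count1+count2 (two∷_ {v} v12) =
    trans (cong suc (length≡count1+count2 v12)) (sym (+-suc (count1 v) (count2 v)))

  sum≡length+count2 : ∀ {v} → Over12 v → sum v ≡ length v + count2 v
  sum≡length+count2 [] = refl
  sum≡length+count2 (one∷ v) = cong suc (sum≡length+count2 v)
  sum≡length+count2 (two∷_ {v} v12) =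
    cong suc (trans (cong suc (sum≡length+count2 v12)) (sym (+-suc (length v) (count2 v))))

  length≤sum : ∀ {v} → Over12 v → length v ≤ sum v
  length≤sum {v} v12 = ≤-trans (m≤m+n (length v) (count2 v)) (≤-reflexive (sym (sum≡length+count2 v12)))

  swap12 : ℕ → ℕ
  swap12 1 = 2
  swap12 _ = 1

  count1-swap12 : ∀ u → count1 (map swap12 u) + count1 u ≡ length u
  count1-swap12 [] = refl
  count1-swap12 (0 ∷ u) = cong suc (count1-swap12 u)
  count1-swap12 (1 ∷ u) = trans (+-suc _ _) (cong suc (count1-swap12 u))
  count1-swap12 (suc (suc _) ∷ u) = cong suc (count1-swap12 u)

  infix 4 _⊑_

  _⊑_ : Word → Word → Set
  u ⊑ v = ∃ λ t → u ++ t ≡ v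

  ⊑-refl : ∀ u → u ⊑ u
  ⊑-refl u = [] , ++-identityʳ u

  ⊑-trans : ∀ {u v w} → u ⊑ v → v ⊑ w → u ⊑ w
  ⊑-trans {u} (s , refl) (t , refl) = s ++ t , sym (++-assoc u s t)

  ⊑-length : ∀ {u v} → u ⊑ v → length u ≤ length v
  ⊑-length {u} (t , refl) = length-++-≤ˡ u

  ⊑-Over12 : ∀ {u v} → u ⊑ v → Over12 v → Over12 u
  ⊑-Over12 {u} (t , refl) = Over12-++ˡ u

  ⊑-count2 : ∀ {u v} → u ⊑ v → count2 u ≤ count2 v
  ⊑-count2 {u} (t , refl) = ≤-trans (m≤m+n (count2 u) (count2 t)) (≤-reflexive (sym (count2-++ u t)))

  ⊑-map : ∀ f {u v} → u ⊑ v → map f u ⊑ map f v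
  ⊑-map f {u} (t , refl) = map f t , sym (map-++ f u t)

  ⊑-compare : ∀ {u v w} → u ⊑ w → v ⊑ w → length u ≤ length v → u ⊑ v
  ⊑-compare {[]} {v} _ _ _ = v , refl
  ⊑-compare {x ∷ u} {y ∷ v} (s , refl) (t , yv≡) (s≤s |u|≤|v|) with ∷-injective yv≡
  ... | refl , v≡ with ⊑-compare (s , refl) (t , v≡) |u|≤|v|
  ...   | r , refl = r , refl

  ⊑-equal-length : ∀ {u v} → u ⊑ v → length u ≡ length v → u ≡ v
  ⊑-equal-length {u} ([] , refl) _ = sym (++-identityʳ u)
  ⊑-equal-length {u} (x ∷ t , refl) |u|≡ = ⊥-elim (m+1+n≢m (length u) (trans (sym (length-++ u)) (sym |u|≡)))

  take-length-++ : ∀ (u v : Word) → take (length u) (u ++ v) ≡ u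
  take-length-++ [] v = refl
  take-length-++ (x ∷ u) v = cong (x ∷_) (take-length-++ u v)

  drop-length-++ : ∀ (u v : Word) → drop (length u) (u ++ v) ≡ v
  drop-length-++ [] v = refl
  drop-length-++ (x ∷ u) v = drop-length-++ u v

  flipTimes : ℕ → Bool → Bool
  flipTimes zero b = b
  flipTimes (suc n) b = flipTimes n (not b)

  integralFrom-++ : ∀ b u v →
    integralFrom b (u ++ v) ≡ integralFrom b u ++ integralFrom (flipTimes (length u) b) v
  integralFrom-++ b [] v = refl
  integralFrom-++ b (a ∷ u) v =
    trans (cong (run ++_) (integralFrom-++ (not b) u v)) (sym (++-assoc run (integralFrom (not b) u) _))
    where run = replicate a (if b then 1 else 2)

  integralFrom-⊑ : ∀ b {u v} → u ⊑ v → integralFrom b u ⊑ integralFrom b v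
  integralFrom-⊑ b {u} (t , refl) = integralFrom (flipTimes (length u) b) t , sym (integralFrom-++ b u t)

  length-integralFrom : ∀ b v → length (integralFrom b v) ≡ sum v
  length-integralFrom b [] = refl
  length-integralFrom b (a ∷ v) =
    trans (length-++ (replicate a _)) (cong₂ _+_ (length-replicate a) (length-integralFrom (not b) v))

  Over12-integralFrom : ∀ b v → Over12 (integralFrom b v)
  Over12-integralFrom b [] = []
  Over12-integralFrom b (a ∷ v) = Over12-run b a (Over12-integralFrom (not b) v)
    where
    Over12-run : ∀ b a {v} → Over12 v → Over12 (replicate a (if b then 1 else 2) ++ v)
    Over12-run b zero v12 = v12
    Over12-run true (suc a) v12 = one∷ Over12-run true a v12
    Over12-run false (suc a) v12 = two∷ Over12-run false a v12

  integralFrom-not : ∀ b v → integralFrom (not b) v ≡ map swap12 (integralFrom b v)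
  integralFrom-not b [] = refl
  integralFrom-not true (a ∷ v) = sym (trans (map-++ swap12 (replicate a 1) _)
    (cong₂ _++_ (map-replicate swap12 a 1) (sym (integralFrom-not false v))))
  integralFrom-not false (a ∷ v) = sym (trans (map-++ swap12 (replicate a 2) _)
    (cong₂ _++_ (map-replicate swap12 a 2) (sym (integralFrom-not true v))))

  flipTimes-parity : ∀ n b → (2 ∣ n × flipTimes n b ≡ b) ⊎ (2 ∣ suc n × flipTimes n b ≡ not b)
  flipTimes-parity zero b = inj₁ (divides 0 refl , refl)
  flipTimes-parity (suc n) b with flipTimes-parity n (not b)
  ... | inj₁ (divides q refl , flip≡) = inj₂ (divides (suc q) refl , flip≡)
  ... | inj₂ (2∣1+n , flip≡) = inj₁ (2∣1+n , trans flip≡ (not-involutive b))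

  2∣n⇒2∤1+n : ∀ {n} → 2 ∣ n → ¬ 2 ∣ suc n
  2∣n⇒2∤1+n {n} 2∣n 2∣1+n with ∣⇒≤ (∣m+n∣m⇒∣n (subst (2 ∣_) (+-comm 1 n) 2∣1+n) 2∣n)
  ... | s≤s ()

  flipTimes-even : ∀ {n} b → 2 ∣ n → flipTimes n b ≡ b
  flipTimes-even {n} b 2∣n with flipTimes-parity n b
  ... | inj₁ (_ , flip≡) = flip≡
  ... | inj₂ (2∣1+n , _) = ⊥-elim (2∣n⇒2∤1+n 2∣n 2∣1+n)

  flipTimes-odd : ∀ {n} b → ¬ 2 ∣ n → flipTimes n b ≡ not b
  flipTimes-odd {n} b 2∤n with flipTimes-parity n b
  ... | inj₁ (2∣n , _) = ⊥-elim (2∤n 2∣n)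
  ... | inj₂ (_ , flip≡) = flip≡

  2*c+2≡2*[1+c] : ∀ c → 2 * c + 2 ≡ 2 * suc c
  2*c+2≡2*[1+c] c = trans (+-comm (2 * c) 2) (sym (*-suc 2 c))

  -- Every run of 1s in an integral has length at most 2 and all but the first follow a 2.
  count1-integralFrom≤ : ∀ {v} → Over12 v →
    count1 (integralFrom true v) ≤ 2 * count2 (integralFrom true v) + 2 ×
    count1 (integralFrom false v) ≤ 2 * count2 (integralFrom false v)
  count1-integralFrom≤ [] = z≤n , z≤n
  count1-integralFrom≤ (one∷ v12) with count1-integralFrom≤ v12
  ... | true≤ , false≤ = ≤-trans (s≤s false≤) (≤-trans (n≤1+n _) (≤-reflexive (+-comm 2 _))) ,
                         ≤-trans true≤ (≤-reflexive (2*c+2≡2*[1+c] _))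
  count1-integralFrom≤ (two∷_ {v} v12) with count1-integralFrom≤ v12
  ... | true≤ , false≤ = ≤-trans (s≤s (s≤s false≤)) (≤-reflexive (+-comm 2 _)) ,
                         ≤-trans true≤ (≤-trans (≤-reflexive (2*c+2≡2*[1+c] _)) (*-monoʳ-≤ 2 (n≤1+n (suc (count2 (integralFrom true v))))))

  approx : ℕ → Word
  approx n = integralIter n (1 ∷ 2 ∷ 2 ∷ [])

  approx-⊑-suc : ∀ n → approx n ⊑ approx (suc n)
  approx-⊑-suc zero = 1 ∷ 1 ∷ [] , refl
  approx-⊑-suc (suc n) = integralFrom-⊑ true (approx-⊑-suc n)

  approx-mono : ∀ {m n} → m ≤′ n → approx m ⊑ approx n
  approx-mono ≤′-refl = ⊑-refl _
  approx-mono (≤′-step {n} m≤′n) = ⊑-trans (approx-mono m≤′n) (approx-⊑-suc n)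

  Over12-approx : ∀ n → Over12 (approx n)
  Over12-approx zero = one∷ two∷ two∷ []
  Over12-approx (suc n) = Over12-integralFrom true (approx n)

  12⊑approx : ∀ n → 1 ∷ 2 ∷ [] ⊑ approx n
  12⊑approx n = ⊑-trans (2 ∷ [] , refl) (approx-mono (≤⇒≤′ {0} {n} z≤n))

  length<sum : ∀ {v} → Over12 v → 1 ∷ 2 ∷ [] ⊑ v → length v < sum v
  length<sum {v} v12 12⊑v = begin-strict
    length v           <⟨ m<m+n (length v) (⊑-count2 12⊑v) ⟩
    length v + count2 v ≡⟨ sum≡length+count2 v12 ⟨
    sum v              ∎
    where open ≤-Reasoning

  length-approx : ∀ n → n + 3 ≤ length (approx n)
  length-approx zero = ≤-refl
  length-approx (suc n) = begin
    suc n + 3               ≤⟨ s≤s (length-approx n) ⟩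
    suc (length (approx n))  ≤⟨ length<sum (Over12-approx n) (12⊑approx n) ⟩
    sum (approx n)           ≡⟨ length-integralFrom true (approx n) ⟨
    length (approx (suc n))  ∎
    where open ≤-Reasoning

  IsSPrefix : Word → Set
  IsSPrefix u = ∃ λ n → u ⊑ approx n

  IsSPrefix-compare : ∀ {u v} → IsSPrefix u → IsSPrefix v → length u ≤ length v → u ⊑ v
  IsSPrefix-compare (m , u⊑) (n , v⊑) = ⊑-compare
    (⊑-trans u⊑ (approx-mono (≤⇒≤′ (m≤m+n m n)))) (⊑-trans v⊑ (approx-mono (≤⇒≤′ (m≤n+m n m))))

  IsSPrefix-integral : ∀ {u} → IsSPrefix u → IsSPrefix (integral u)
  IsSPrefix-integral (n , u⊑) = suc n , integralFrom-⊑ true u⊑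

  Over12-IsSPrefix : ∀ {u} → IsSPrefix u → Over12 u
  Over12-IsSPrefix (n , u⊑) = ⊑-Over12 u⊑ (Over12-approx n)

  Sprefix-IsSPrefix : ∀ n → IsSPrefix (Sprefix n)
  Sprefix-IsSPrefix n = n , drop n (approx n) , take++drop≡id n (approx n)

  length-Sprefix : ∀ n → length (Sprefix n) ≡ n
  length-Sprefix n = trans (length-take n (approx n)) (m≤n⇒m⊓n≡m (≤-trans (m≤m+n n 3) (length-approx n)))

  IsSPrefix⇒≡Sprefix : ∀ {u} → IsSPrefix u → u ≡ Sprefix (length u)
  IsSPrefix⇒≡Sprefix {u} u∈S = ⊑-equal-length
    (IsSPrefix-compare u∈S (Sprefix-IsSPrefix (length u)) (≤-reflexive (sym (length-Sprefix (length u)))))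
    (sym (length-Sprefix (length u)))

  Sprefix-⊑ : ∀ {m n} → m ≤ n → Sprefix m ⊑ Sprefix n
  Sprefix-⊑ {m} {n} m≤n = IsSPrefix-compare (Sprefix-IsSPrefix m) (Sprefix-IsSPrefix n)
    (subst₂ _≤_ (sym (length-Sprefix m)) (sym (length-Sprefix n)) m≤n)

  IsSPrefix-⊑-integral : ∀ {u} → IsSPrefix u → u ⊑ integral u
  IsSPrefix-⊑-integral {u} u∈S = IsSPrefix-compare u∈S (IsSPrefix-integral u∈S)
    (≤-trans (length≤sum (Over12-IsSPrefix u∈S)) (≤-reflexive (sym (length-integralFrom true u))))

  Sprefix-suc-⊑-integral : ∀ {r v} → 2 ≤ r → Sprefix r ⊑ v → Sprefix (suc r) ⊑ integral v
  Sprefix-suc-⊑-integral {r} 2≤r Sr⊑v =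
    ⊑-trans (IsSPrefix-compare (Sprefix-IsSPrefix (suc r)) (IsSPrefix-integral (Sprefix-IsSPrefix r)) |Sr+1|≤)
            (integralFrom-⊑ true Sr⊑v)
    where
    |Sr+1|≤ : length (Sprefix (suc r)) ≤ length (integral (Sprefix r))
    |Sr+1|≤ = begin
      length (Sprefix (suc r))     ≡⟨ trans (length-Sprefix (suc r)) (cong suc (sym (length-Sprefix r))) ⟩
      suc (length (Sprefix r))     ≤⟨ length<sum (Over12-IsSPrefix (Sprefix-IsSPrefix r)) (Sprefix-⊑ 2≤r) ⟩
      sum (Sprefix r)              ≡⟨ length-integralFrom true (Sprefix r) ⟨
      length (integral (Sprefix r)) ∎
      where open ≤-Reasoning

  Regular-[] : ∀ k → Regular k []
  Regular-[] k h _ = subst (λ v → 2 ∣ length v) (sym (integralIter-[] h)) (divides 0 refl)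
    where
    integralIter-[] : ∀ h → integralIter h [] ≡ []
    integralIter-[] zero = refl
    integralIter-[] (suc h) = cong integral (integralIter-[] h)

  Regular-suc : ∀ {k w} → Regular k w → 2 ∣ length (integralIter (suc k) w) → Regular (suc k) w
  Regular-suc {k} reg 2∣ h h≤1+k with m≤n⇒m<n∨m≡n h≤1+k
  ... | inj₁ h<1+k = reg h (s≤s⁻¹ h<1+k)
  ... | inj₂ refl = 2∣

  Normal⇒2≤length : ∀ {k w} → Normal k w → 2 ≤ length w
  Normal⇒2≤length {w = []} (_ , irregular) = ⊥-elim (irregular (Regular-[] _))
  Normal⇒2≤length {w = _ ∷ []} (regular , _) = ⊥-elim (2∣n⇒2∤1+n (divides 0 refl) (regular 0 z≤n))
  Normal⇒2≤length {w = _ ∷ _ ∷ _} _ = s≤s (s≤s z≤n)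

  12⊑integral² : ∀ {v} → Over12 v → 2 ≤ sum v → 1 ∷ 2 ∷ [] ⊑ integral (integral v)
  12⊑integral² (one∷ []) (s≤s ())
  12⊑integral² (one∷ one∷ _) _ = _ , refl
  12⊑integral² (one∷ two∷ _) _ = _ , refl
  12⊑integral² (two∷ _) _ = _ , refl

  module Blocks {w : Word} (w∈S : IsSPrefix w) where

    IsSPrefix-iter : ∀ h → IsSPrefix (integralIter h w)
    IsSPrefix-iter zero = w∈S
    IsSPrefix-iter (suc h) = IsSPrefix-integral (IsSPrefix-iter h)

    Over12-iter : ∀ h → Over12 (integralIter h w)
    Over12-iter h = Over12-IsSPrefix (IsSPrefix-iter h)

    iter-split : ∀ m → integralIter (suc m) w ≡ integralIter m w ++ block w (suc m)
    iter-split m with IsSPrefix-⊑-integral (IsSPrefix-iter m)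
    ... | t , u++t≡ = begin
      integralIter (suc m) w                ≡⟨ u++t≡ ⟨
      u ++ t                                ≡⟨ cong (u ++_) (drop-length-++ u t) ⟨
      u ++ drop (length u) (u ++ t)         ≡⟨ cong (λ v → u ++ drop (length u) v) u++t≡ ⟩
      u ++ block w (suc m)                  ∎
      where
      open ≡-Reasoning
      u = integralIter m w

    block-suc-suc : ∀ m →
      block w (suc (suc m)) ≡ integralFrom (flipTimes (length (integralIter m w)) true) (block w (suc m))
    block-suc-suc m = begin
      drop (length u′) (integral u′)                                     ≡⟨ cong (λ v → drop (length u′) (integral v)) (iter-split m) ⟩
      drop (length u′) (integral (u ++ b))                               ≡⟨ cong (drop (length u′)) (integralFrom-++ true u b) ⟩
      drop (length u′) (u′ ++ integralFrom (flipTimes (length u) true) b) ≡⟨ drop-length-++ u′ _ ⟩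
      integralFrom (flipTimes (length u) true) b                          ∎
      where
      open ≡-Reasoning
      u = integralIter m w
      u′ = integralIter (suc m) w
      b = block w (suc m)

    Over12-block : ∀ m → Over12 (block w (suc m))
    Over12-block m = Over12-++ʳ (integralIter m w) (subst Over12 (iter-split m) (Over12-iter (suc m)))

    length-block : ∀ m → length (block w (suc m)) ≡ count2 (integralIter m w)
    length-block m = +-cancelˡ-≡ (length u) _ _ (begin
      length u + length (block w (suc m)) ≡⟨ length-++ u ⟨
      length (u ++ block w (suc m))       ≡⟨ cong length (iter-split m) ⟨
      length (integral u)                 ≡⟨ length-integralFrom true u ⟩
      sum u                               ≡⟨ sum≡length+count2 (Over12-iter m) ⟩
      length u + count2 u                 ∎)
      where
      open ≡-Reasoning
      u = integralIter m w

    -- |b_{m+2}| counts the 2s of w^{-(m+1)}, which has at most 2|b_{m+2}| + 2 ones.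
    length-iter≤4*length-block : ∀ m → 2 ≤ length (block w (suc (suc m))) →
      length (integralIter (suc m) w) ≤ 4 * length (block w (suc (suc m)))
    length-iter≤4*length-block m 2≤c = begin
      length u′                  ≡⟨ length≡count1+count2 (Over12-iter (suc m)) ⟩
      count1 u′ + count2 u′      ≡⟨ cong (count1 u′ +_) c≡ ⟨
      count1 u′ + c              ≤⟨ +-monoˡ-≤ c (proj₁ (count1-integralFrom≤ (Over12-iter m))) ⟩
      2 * count2 u′ + 2 + c      ≡⟨ cong (λ x → 2 * x + 2 + c) c≡ ⟨
      2 * c + 2 + c              ≤⟨ +-monoˡ-≤ c (+-monoʳ-≤ (2 * c) 2≤c) ⟩
      2 * c + c + c              ≡⟨ solve 1 (λ x → con 2 :* x :+ x :+ x := con 4 :* x) refl c ⟩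
      4 * c                      ∎
      where
      open ≤-Reasoning
      open +-*-Solver
      u′ = integralIter (suc m) w
      c = length (block w (suc (suc m)))
      c≡ : c ≡ count2 u′
      c≡ = length-block (suc m)

  2≤sum-first-block : ∀ {p} → 2 ≤ p → 2 ≤ sum (block (Sprefix p) 1)
  2≤sum-first-block {1} (s≤s ())
  2≤sum-first-block {2} _ = ≤-refl
  2≤sum-first-block {suc (suc (suc p))} _ = begin
    2                  ≤⟨ ⊑-count2 (Sprefix-⊑ {3} {3 + p} (s≤s (s≤s (s≤s z≤n)))) ⟩
    count2 w           ≡⟨ length-block 0 ⟨
    length (block w 1) ≤⟨ length≤sum (Over12-block 0) ⟩
    sum (block w 1)    ∎
    where
    open ≤-Reasoning
    w = Sprefix (3 + p)
    open Blocks (Sprefix-IsSPrefix (3 + p))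

  module NormalPrefix {k p : ℕ} (1≤k : 1 ≤ k) (normal : Normal k (Sprefix p)) where

    open Blocks (Sprefix-IsSPrefix p) public

    private
      w : Word
      w = Sprefix p
      regular : Regular k w
      regular = proj₁ normal

    2≤p : 2 ≤ p
    2≤p = subst (2 ≤_) (length-Sprefix p) (Normal⇒2≤length normal)

    block-integral : ∀ h → h ≤ k → block w (2 + h) ≡ integral (block w (1 + h))
    block-integral h h≤k =
      trans (block-suc-suc h) (cong (λ b → integralFrom b (block w (1 + h))) (flipTimes-even true (regular h h≤k)))

    block-swap12 : block w (3 + k) ≡ map swap12 (integral (block w (2 + k)))
    block-swap12 = trans (block-suc-suc (suc k))
      (trans (cong (λ b → integralFrom b (block w (2 + k))) (flipTimes-odd true odd)) (integralFrom-not true (block w (2 + k))))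
      where
      odd : ¬ 2 ∣ length (integralIter (suc k) w)
      odd 2∣ = proj₂ normal (Regular-suc regular 2∣)

    Sprefix-⊑-block : ∀ i → 1 ≤ i → i ≤ k → Sprefix (suc i) ⊑ block w (2 + i)
    Sprefix-⊑-block 1 _ _ = subst (Sprefix 2 ⊑_) (sym block₃≡)
      (12⊑integral² (Over12-block 0) (2≤sum-first-block 2≤p))
      where
      block₃≡ : block w 3 ≡ integral (integral (block w 1))
      block₃≡ = trans (block-integral 1 1≤k) (cong integral (block-integral 0 z≤n))
    Sprefix-⊑-block (suc (suc i)) _ 2+i≤k = subst (Sprefix (3 + i) ⊑_) (sym (block-integral (2 + i) 2+i≤k))
      (Sprefix-suc-⊑-integral (s≤s (s≤s z≤n)) (Sprefix-⊑-block (suc i) (s≤s z≤n) (≤-trans (n≤1+n _) 2+i≤k)))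

    swap12-Sprefix-⊑-block : map swap12 (Sprefix (suc k)) ⊑ block w (3 + k)
    swap12-Sprefix-⊑-block = subst (map swap12 (Sprefix (suc k)) ⊑_) (sym block-swap12)
      (⊑-map swap12 (⊑-trans (IsSPrefix-⊑-integral (Sprefix-IsSPrefix (suc k)))
                             (integralFrom-⊑ true (Sprefix-⊑-block k 1≤k ≤-refl))))

    suc-k≤length-block : suc k ≤ length (block w (3 + k))
    suc-k≤length-block = subst (_≤ length (block w (3 + k)))
      (trans (length-map swap12 (Sprefix (suc k))) (length-Sprefix (suc k))) (⊑-length swap12-Sprefix-⊑-block)

    suc-k≤length-iter : suc k ≤ length (integralIter (2 + k) w)
    suc-k≤length-iter = begin
      suc k                                                        ≡⟨ length-Sprefix (suc k) ⟨
      length (Sprefix (suc k))                                     ≤⟨ ⊑-length (Sprefix-⊑-block k 1≤k ≤-refl) ⟩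
      length (block w (2 + k))                                     ≤⟨ length-++-≤ʳ (block w (2 + k)) {integralIter (suc k) w} ⟩
      length (integralIter (suc k) w ++ block w (2 + k))           ≡⟨ cong length (iter-split (suc k)) ⟨
      length (integralIter (2 + k) w)                              ∎
      where open ≤-Reasoning

    length-iter≤4*length-last-block : length (integralIter (2 + k) w) ≤ 4 * length (block w (3 + k))
    length-iter≤4*length-last-block = length-iter≤4*length-block (suc k) (≤-trans (s≤s 1≤k) suc-k≤length-block)

module Frequencies where

  open KolakoskiWords using (count1-++)

  open import Data.Nat as ℕ using (ℕ; suc)
  import Data.Nat.Properties as ℕ
  open import Data.Integer as ℤ using (+_; +≤+)
  import Data.Integer.Properties as ℤ
  open import Data.Integer.Solver renaming (module +-*-Solver to ℤ-Solver)
  open import Data.List using (length; _++_)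
  open import Data.List.Properties using (length-++; length-++-≤ˡ)
  open import Data.Rational.Unnormalised
  open import Data.Rational.Unnormalised.Properties
  open import Data.Rational.Unnormalised.Solver using (module +-*-Solver)
  open import Relation.Binary.PropositionalEquality using (_≡_; refl; cong; sym; trans; module ≡-Reasoning)

  fromℕ : ℕ → ℚᵘ
  fromℕ n = mkℚᵘ (+ n) 0

  fromℕ-+ : ∀ m n → fromℕ (m ℕ.+ n) ≃ fromℕ m + fromℕ n
  fromℕ-+ m n = *≡* (trans (cong (ℤ._* + 1) (ℤ.pos-+ m n))
    (solve 2 (λ x y → (x :+ y) :* con (+ 1) := (x :* con (+ 1) :+ y :* con (+ 1)) :* con (+ 1)) refl (+ m) (+ n)))
    where open ℤ-Solver

  fromℕ-* : ∀ m n → fromℕ (m ℕ.* n) ≃ fromℕ m * fromℕ n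
  fromℕ-* m n = *≡* (cong (ℤ._* + 1) (ℤ.pos-* m n))

  fromℕ-mono-≤ : ∀ {m n} → m ℕ.≤ n → fromℕ m ≤ fromℕ n
  fromℕ-mono-≤ m≤n = *≤* (ℤ.*-monoʳ-≤-nonNeg (+ 1) (+≤+ m≤n))

  fromℕ-positive : ∀ {n} → 1 ℕ.≤ n → Positive (fromℕ n)
  fromℕ-positive (ℕ.s≤s _) = _

  freq1*length : ∀ v → 1 ℕ.≤ length v → freq1 v * fromℕ (length v) ≃ fromℕ (count1 v)
  freq1*length v 1≤|v| with length v
  ... | suc d = *≡* (trans (ℤ.*-identityʳ _) (cong (λ e → + count1 v ℤ.* + e) (sym (ℕ.*-identityʳ (suc d)))))

  freq1-complement : ∀ u v → length u ≡ length v → 1 ℕ.≤ length v → count1 u ℕ.+ count1 v ≡ length v →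
    freq1 u + freq1 v ≃ 1ℚᵘ
  freq1-complement u v |u|≡|v| 1≤|v| sum≡ with length u | length v
  freq1-complement u v refl 1≤|v| sum≡ | suc d | .(suc d) = *≡* (begin
    (+ a ℤ.* + suc d ℤ.+ + b ℤ.* + suc d) ℤ.* + 1 ≡⟨ solve 3 (λ x y z → (x :* z :+ y :* z) :* con (+ 1) := con (+ 1) :* ((x :+ y) :* z)) refl (+ a) (+ b) (+ suc d) ⟩
    + 1 ℤ.* ((+ a ℤ.+ + b) ℤ.* + suc d)           ≡⟨ cong (λ e → + 1 ℤ.* (e ℤ.* + suc d)) (trans (sym (ℤ.pos-+ a b)) (cong +_ sum≡)) ⟩
    + 1 ℤ.* (+ suc d ℤ.* + suc d)                 ≡⟨ cong (+ 1 ℤ.*_) (ℤ.pos-* (suc d) (suc d)) ⟨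
    + 1 ℤ.* + (suc d ℕ.* suc d)                   ∎)
    where
    open ≡-Reasoning
    open ℤ-Solver
    a = count1 u
    b = count1 v

  ∣p-q∣≃∣q-p∣ : ∀ p q → ∣ p - q ∣ ≃ ∣ q - p ∣
  ∣p-q∣≃∣q-p∣ p q = ≃-trans (∣-∣-cong (solve 2 (λ x y → x :- y := :- (y :- x)) ≃-refl p q)) (∣-p∣≃∣p∣ (q - p))
    where open +-*-Solver

  ∣p-r∣≤∣p-q∣+∣q-r∣ : ∀ p q r → ∣ p - r ∣ ≤ ∣ p - q ∣ + ∣ q - r ∣
  ∣p-r∣≤∣p-q∣+∣q-r∣ p q r = begin
    ∣ p - r ∣               ≃⟨ ∣-∣-cong (solve 3 (λ x y z → x :- z := (x :- y) :+ (y :- z)) ≃-refl p q r) ⟩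
    ∣ (p - q) + (q - r) ∣   ≤⟨ ∣p+q∣≤∣p∣+∣q∣ (p - q) (q - r) ⟩
    ∣ p - q ∣ + ∣ q - r ∣   ∎
    where
    open ≤-Reasoning
    open +-*-Solver

  -- freq1 (u ++ t) is the mean of freq1 u and freq1 t weighted by |u| and |t|.
  freq1-++-distance : ∀ u t c → 1 ℕ.≤ length u → 1 ℕ.≤ length t → length u ℕ.≤ c ℕ.* length t →
    ∣ freq1 t - freq1 (u ++ t) ∣ ≤ fromℕ c * ∣ freq1 (u ++ t) - freq1 u ∣
  freq1-++-distance u t c 1≤|u| 1≤|t| |u|≤c|t| = *-cancelʳ-≤-pos |t| {{ fromℕ-positive 1≤|t| }} (begin
    ∣ fT - fUT ∣ * |t|                 ≃⟨ ∣p*q∣≃∣p∣*∣q∣ (fT - fUT) |t| ⟨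
    ∣ (fT - fUT) * |t| ∣               ≃⟨ ∣-∣-cong balance ⟩
    ∣ (fUT - fU) * |u| ∣               ≃⟨ ∣p*q∣≃∣p∣*∣q∣ (fUT - fU) |u| ⟩
    ∣ fUT - fU ∣ * |u|                 ≤⟨ *-monoʳ-≤-nonNeg ∣ fUT - fU ∣ {{ ∣-∣-nonNeg (fUT - fU) }} (fromℕ-mono-≤ |u|≤c|t|) ⟩
    ∣ fUT - fU ∣ * fromℕ (c ℕ.* length t) ≃⟨ *-congˡ {∣ fUT - fU ∣} (fromℕ-* c (length t)) ⟩
    ∣ fUT - fU ∣ * (fromℕ c * |t|)     ≃⟨ solve 3 (λ a b x → a :* (b :* x) := (b :* a) :* x) ≃-refl ∣ fUT - fU ∣ (fromℕ c) |t| ⟩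
    (fromℕ c * ∣ fUT - fU ∣) * |t|     ∎)
    where
    open ≤-Reasoning
    open +-*-Solver
    fT = freq1 t
    fU = freq1 u
    fUT = freq1 (u ++ t)
    |t| = fromℕ (length t)
    |u| = fromℕ (length u)
    fUT*|u++t| : fUT * (|u| + |t|) ≃ fromℕ (count1 u) + fromℕ (count1 t)
    fUT*|u++t| = begin-equality
      fUT * (|u| + |t|)                 ≃⟨ *-congˡ {fUT} (fromℕ-+ (length u) (length t)) ⟨
      fUT * fromℕ (length u ℕ.+ length t) ≃⟨ *-congˡ {fUT} (≃-reflexive (cong fromℕ (length-++ u))) ⟨
      fUT * fromℕ (length (u ++ t))     ≃⟨ freq1*length (u ++ t) (ℕ.≤-trans 1≤|u| (length-++-≤ˡ u)) ⟩
      fromℕ (count1 (u ++ t))           ≃⟨ ≃-reflexive (cong fromℕ (count1-++ u t)) ⟩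
      fromℕ (count1 u ℕ.+ count1 t)     ≃⟨ fromℕ-+ (count1 u) (count1 t) ⟩
      fromℕ (count1 u) + fromℕ (count1 t) ∎
    balance : (fT - fUT) * |t| ≃ (fUT - fU) * |u|
    balance = p-q≃0⇒p≃q _ _ (begin-equality
      (fT - fUT) * |t| - (fUT - fU) * |u|    ≃⟨ solve 5 (λ a b c x y → (b :- c) :* y :- (c :- a) :* x := (b :* y :+ a :* x) :- c :* (x :+ y)) ≃-refl fU fT fUT |u| |t| ⟩
      (fT * |t| + fU * |u|) - fUT * (|u| + |t|) ≃⟨ +-cong (+-cong (freq1*length t 1≤|t|) (freq1*length u 1≤|u|)) (-‿cong fUT*|u++t|) ⟩
      (fromℕ (count1 t) + fromℕ (count1 u)) - (fromℕ (count1 u) + fromℕ (count1 t)) ≃⟨ solve 2 (λ x y → (x :+ y) :- (y :+ x) := con 0ℚᵘ) ≃-refl (fromℕ (count1 t)) (fromℕ (count1 u)) ⟩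
      0ℚᵘ                                    ∎)

  freq1-suffix-close : ∀ {x δ} u t c .{{_ : ℕ.NonZero c}} → 1 ℕ.≤ length u → 1 ℕ.≤ length t →
    length u ℕ.≤ c ℕ.* length t → ∣ x - freq1 u ∣ < δ → ∣ x - freq1 (u ++ t) ∣ < δ →
    ∣ x - freq1 t ∣ < δ + fromℕ c * (δ + δ)
  freq1-suffix-close {x} {δ} u t c 1≤|u| 1≤|t| |u|≤c|t| x≈u x≈ut = begin-strict
    ∣ x - fT ∣                ≤⟨ ∣p-r∣≤∣p-q∣+∣q-r∣ x fUT fT ⟩
    ∣ x - fUT ∣ + ∣ fUT - fT ∣ <⟨ +-mono-< x≈ut ut≈t ⟩
    δ + fromℕ c * (δ + δ)     ∎
    where
    open ≤-Reasoning
    fT = freq1 t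
    fU = freq1 u
    fUT = freq1 (u ++ t)
    ut≈t : ∣ fUT - fT ∣ < fromℕ c * (δ + δ)
    ut≈t = begin-strict
      ∣ fUT - fT ∣                         ≃⟨ ∣p-q∣≃∣q-p∣ fUT fT ⟩
      ∣ fT - fUT ∣                         ≤⟨ freq1-++-distance u t c 1≤|u| 1≤|t| |u|≤c|t| ⟩
      fromℕ c * ∣ fUT - fU ∣               ≤⟨ *-monoʳ-≤-nonNeg (fromℕ c) (∣p-r∣≤∣p-q∣+∣q-r∣ fUT x fU) ⟩
      fromℕ c * (∣ fUT - x ∣ + ∣ x - fU ∣) <⟨ *-monoʳ-<-pos (fromℕ c) {{fromℕ-positive (ℕ.>-nonZero⁻¹ c)}}
                                               (+-mono-< (≤-<-trans (≤-reflexive (∣p-q∣≃∣q-p∣ fUT x)) x≈ut) x≈u) ⟩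
      fromℕ c * (δ + δ)                    ∎

  near-½ : ∀ {x a b ε} → ∣ x - a ∣ < ε → ∣ x - b ∣ < ε → a + b ≃ 1ℚᵘ → ∣ x - ½ ∣ < ε
  near-½ {x} {a} {b} {ε} ∣x-a∣<ε ∣x-b∣<ε a+b≃1 = *-cancelʳ-<-nonNeg two (begin-strict
    ∣ x - ½ ∣ * two                                ≃⟨ ∣p*q∣≃∣p∣*∣q∣ (x - ½) two ⟨
    ∣ (x - ½) * two ∣                              ≃⟨ ∣-∣-cong (solve 4 (λ x a b h → (x :- h) :* con two := ((x :- a) :+ (x :- b)) :+ ((a :+ b) :- h :* con two)) ≃-refl x a b ½) ⟩
    ∣ ((x - a) + (x - b)) + ((a + b) - ½ * two) ∣ ≃⟨ ∣-∣-cong (≃-trans (+-congʳ ((x - a) + (x - b)) (p≃q⇒p-q≃0 _ _ (≃-trans a+b≃1 (*≡* refl)))) (+-identityʳ _)) ⟩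
    ∣ (x - a) + (x - b) ∣                          ≤⟨ ∣p+q∣≤∣p∣+∣q∣ (x - a) (x - b) ⟩
    ∣ x - a ∣ + ∣ x - b ∣                          <⟨ +-mono-< ∣x-a∣<ε ∣x-b∣<ε ⟩
    ε + ε                                          ≃⟨ solve 1 (λ e → e :+ e := e :* con two) ≃-refl ε ⟩
    ε * two                                        ∎)
    where
    open ≤-Reasoning
    open +-*-Solver
    two = fromℕ 2

  _/10 : ℚᵘ → ℚᵘ
  ε /10 = mkℚᵘ (+ 1) 9 * ε

  /10-positive : ∀ {ε} → 0ℚᵘ < ε → 0ℚᵘ < ε /10
  /10-positive {ε} 0<ε = positive⁻¹ (ε /10) {{pos*pos⇒pos (mkℚᵘ (+ 1) 9) ε {{positive 0<ε}}}}

  /10<id : ∀ {ε} → 0ℚᵘ < ε → ε /10 < ε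
  /10<id {ε} 0<ε = <-≤-trans (*-monoˡ-<-pos ε {{positive 0<ε}} {mkℚᵘ (+ 1) 9} {1ℚᵘ} (*<* (ℤ.+<+ (ℕ.s≤s (ℕ.s≤s ℕ.z≤n)))))
                             (≤-reflexive (*-identityˡ ε))

  /10-budget : ∀ ε → ε /10 + fromℕ 4 * (ε /10 + ε /10) + ε /10 ≃ ε
  /10-budget ε = begin-equality
    t * ε + fromℕ 4 * (t * ε + t * ε) + t * ε ≃⟨ solve 3 (λ t f e → t :* e :+ f :* (t :* e :+ t :* e) :+ t :* e := (t :+ f :* (t :+ t) :+ t) :* e) ≃-refl t (fromℕ 4) ε ⟩
    (t + fromℕ 4 * (t + t) + t) * ε         ≃⟨ *-congʳ {ε} ten-tenths ⟩
    1ℚᵘ * ε                                   ≃⟨ *-identityˡ ε ⟩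
    ε                                         ∎
    where
    open ≤-Reasoning
    open +-*-Solver
    t = mkℚᵘ (+ 1) 9
    ten-tenths : t + fromℕ 4 * (t + t) + t ≃ 1ℚᵘ
    ten-tenths = *≡* refl

open import Data.Nat using (ℕ; zero; suc; _+_; _∸_; _≤_; _<_; z≤n; s≤s; s≤s⁻¹)
import Data.Nat.Properties as ℕ
open import Data.Nat.Divisibility using (_∣_; _∣?_)
open import Data.Nat.Induction using (<-rec)
open import Data.List using (length; take; map; _++_)
open import Data.List.Properties using (length-map; length-++-≤ˡ)
open import Data.Product using (Σ; _×_; ∃; _,_; proj₁; proj₂)
open import Data.Integer using (+_)
open import Data.Rational.Unnormalised as ℚ using (ℚᵘ; mkℚᵘ; 0ℚᵘ; ½; _-_; ∣_∣)
  renaming (_<_ to _<q_; _+_ to _+q_; _*_ to _*q_)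
import Data.Rational.Unnormalised.Properties as ℚ
open import Function using (case_of_)
open import Relation.Binary.PropositionalEquality using (_≡_; sym; trans; cong; cong₂; subst; module ≡-Reasoning)
open import Relation.Nullary using (¬_; Dec; yes; no; map′)
open import Relation.Nullary.Decidable using (_×-dec_; ¬?)

open KolakoskiWords
open Frequencies

Regular? : ∀ k w → Dec (Regular k w)
Regular? k w = map′ {A = ∀ {h} → h < suc k → 2 ∣ length (integralIter h w)}
  (λ below h h≤k → below (s≤s h≤k)) (λ reg h<1+k → reg _ (s≤s⁻¹ h<1+k))
  (ℕ.allUpTo? (λ h → 2 ∣? length (integralIter h w)) (suc k))

Normal? : ∀ k w → Dec (Normal k w)
Normal? k w = Regular? k w ×-dec ¬? (Regular? (suc k) w)

least-witness : ∀ {P : ℕ → Set} → (∀ n → Dec (P n)) → ∀ n → P n → ∃ λ m → P m × (∀ i → i < m → ¬ P i)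
least-witness P? = <-rec _ λ n recurse Pn → case ℕ.anyUpTo? P? n of λ where
  (yes (m , m<n , Pm)) → recurse m<n Pm
  (no none) → n , Pn , λ i i<n Pi → none (i , i<n , Pi)

minimal-prefix : ∀ {k p} → Normal k (Sprefix p) → ∃ λ p′ → IsMinimal k p′
minimal-prefix {k} {p} = least-witness (λ m → Normal? k (Sprefix m)) p

module _ {ε : ℚᵘ} {N : ℕ}
  (cauchy : ∀ m n → N ≤ m → N ≤ n → ∣ freq1 (Sprefix (suc m)) - freq1 (Sprefix (suc n)) ∣ <q ε /10) where

  close-to-IsSPrefix : ∀ {n Q} → N ≤ n → IsSPrefix Q → N < length Q →
    ∣ freq1 (Sprefix (suc n)) - freq1 Q ∣ <q ε /10
  close-to-IsSPrefix {n} {Q} N≤n Q∈S N<|Q| = subst (λ v → ∣ freq1 (Sprefix (suc n)) - freq1 v ∣ <q ε /10)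
    (sym (trans (IsSPrefix⇒≡Sprefix Q∈S) (cong Sprefix |Q|≡1+q)))
    (cauchy n q N≤n (s≤s⁻¹ (subst (N <_) |Q|≡1+q N<|Q|)))
    where
    q = length Q ∸ 1
    |Q|≡1+q : length Q ≡ suc q
    |Q|≡1+q = trans (sym (ℕ.m∸n+n≡m (ℕ.m<n⇒0<n N<|Q|))) (ℕ.+-comm q 1)

  near-½-at-normal-prefix : ∀ {k p} → 0ℚᵘ <q ε → 1 ≤ k → N ≤ k → Normal k (Sprefix p) →
    ∣ freq1 (block (Sprefix p) (3 + k)) - freq1 (take (suc k) (block (Sprefix p) (3 + k))) ∣ <q ε /10 →
    ∀ n → N ≤ n → ∣ freq1 (Sprefix (suc n)) - ½ ∣ <q ε
  near-½-at-normal-prefix {k} {p} 0<ε 1≤k N≤k normal B≈prefix n N≤n =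
    near-½ {x} {freq1 c} {freq1 S} x≈c (ℚ.<-trans x≈S (/10<id 0<ε))
      (freq1-complement c S (length-map swap12 S) (ℕ.≤-trans (s≤s z≤n) N<|S|) (count1-swap12 S))
    where
    open NormalPrefix 1≤k normal
    x = freq1 (Sprefix (suc n))
    S = Sprefix (suc k)
    c = map swap12 S
    Q = integralIter (2 + k) (Sprefix p)
    B = block (Sprefix p) (3 + k)
    N<|S| : N < length S
    N<|S| = subst (N <_) (sym (length-Sprefix (suc k))) (s≤s N≤k)
    x≈S : ∣ x - freq1 S ∣ <q ε /10
    x≈S = close-to-IsSPrefix N≤n (Sprefix-IsSPrefix (suc k)) N<|S|
    N<|Q| : N < length Q
    N<|Q| = ℕ.≤-trans (s≤s N≤k) suc-k≤length-iter
    x≈B : ∣ x - freq1 B ∣ <q ε /10 +q fromℕ 4 *q (ε /10 +q ε /10)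
    x≈B = freq1-suffix-close {x} {ε /10} Q B 4 (ℕ.≤-trans (s≤s z≤n) N<|Q|) (ℕ.≤-trans (s≤s z≤n) suc-k≤length-block)
      length-iter≤4*length-last-block
      (close-to-IsSPrefix N≤n (IsSPrefix-iter (2 + k)) N<|Q|)
      (close-to-IsSPrefix N≤n (subst IsSPrefix (iter-split (2 + k)) (IsSPrefix-iter (3 + k)))
        (ℕ.≤-trans N<|Q| (length-++-≤ˡ Q)))
    B≈c : ∣ freq1 B - freq1 c ∣ <q ε /10
    B≈c with swap12-Sprefix-⊑-block
    ... | t , c++t≡B = subst (λ v → ∣ freq1 B - freq1 v ∣ <q ε /10) (begin
      take (suc k) B           ≡⟨ cong₂ take (trans (sym (length-Sprefix (suc k))) (sym (length-map swap12 S))) (sym c++t≡B) ⟩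
      take (length c) (c ++ t) ≡⟨ take-length-++ c t ⟩
      c                        ∎) B≈prefix
      where open ≡-Reasoning
    x≈c : ∣ x - freq1 c ∣ <q ε
    x≈c = begin-strict
      ∣ x - freq1 c ∣                                        ≤⟨ ∣p-r∣≤∣p-q∣+∣q-r∣ x (freq1 B) (freq1 c) ⟩
      ∣ x - freq1 B ∣ +q ∣ freq1 B - freq1 c ∣                <⟨ ℚ.+-mono-< x≈B B≈c ⟩
      ε /10 +q fromℕ 4 *q (ε /10 +q ε /10) +q ε /10          ≃⟨ /10-budget ε ⟩
      ε                                                      ∎
      where open ℚ.≤-Reasoning

increasing⇒≥id : ∀ {f : ℕ → ℕ} → (∀ n → f n < f (suc n)) → ∀ n → n ≤ f n
increasing⇒≥id f-inc zero = z≤n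
increasing⇒≥id f-inc (suc n) = ℕ.≤-trans (s≤s (increasing⇒≥id f-inc n)) (f-inc n)

theorem5 : (∀ (ε : ℚᵘ) → 0ℚᵘ <q ε → ∃ λ N → ∀ m n → N ≤ m → N ≤ n →
              ∣ freq1 (Sprefix (suc m)) - freq1 (Sprefix (suc n)) ∣ <q ε)
  → (kk : ℕ → ℕ)
  → (∀ n → 0 < kk n)
  → (∀ n → kk n < kk (suc n))
  → (∀ n → ∃ λ p → Normal (kk n) (Sprefix p))
  → (∀ (ε : ℚᵘ) → 0ℚᵘ <q ε → Σ ℕ λ L → 0 < L ×
       (∀ n p m → IsMinimal (kk n) p → 0 < m → L < length (block (Sprefix p) m) →
          ∀ j → L ≤ j → j ≤ length (block (Sprefix p) m) →
          ∣ freq1 (block (Sprefix p) m) - freq1 (take j (block (Sprefix p) m)) ∣ <q ε))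
  → ∀ (ε : ℚᵘ) → 0ℚᵘ <q ε → ∃ λ N → ∀ n → N ≤ n →
       ∣ freq1 (Sprefix (suc n)) - mkℚᵘ (+ 1) 1 ∣ <q ε
theorem5 cauchy kk 0<kk kk-increasing normal-exists blocks-regular ε 0<ε
  with cauchy (ε /10) (/10-positive 0<ε) | blocks-regular (ε /10) (/10-positive 0<ε)
... | N , cauchy-ε | L , _ , blocks-regular-ε =
  N , near-½-at-normal-prefix cauchy-ε 0<ε (0<kk n₀) N≤k (proj₁ minimal) B≈prefix
  where
  n₀ = N + L
  k = kk n₀
  N≤k : N ≤ k
  N≤k = ℕ.≤-trans (ℕ.m≤m+n N L) (increasing⇒≥id kk-increasing n₀)
  L≤k : L ≤ k
  L≤k = ℕ.≤-trans (ℕ.m≤n+m L N) (increasing⇒≥id kk-increasing n₀)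
  p = proj₁ (minimal-prefix (proj₂ (normal-exists n₀)))
  minimal : IsMinimal k p
  minimal = proj₂ (minimal-prefix (proj₂ (normal-exists n₀)))
  k<|B| : suc k ≤ length (block (Sprefix p) (3 + k))
  k<|B| = NormalPrefix.suc-k≤length-block (0<kk n₀) (proj₁ minimal)
  B≈prefix : ∣ freq1 (block (Sprefix p) (3 + k)) - freq1 (take (suc k) (block (Sprefix p) (3 + k))) ∣ <q ε /10
  B≈prefix = blocks-regular-ε n₀ p (3 + k) minimal (s≤s z≤n)
    (ℕ.≤-trans (s≤s L≤k) k<|B|) (suc k) (ℕ.≤-trans L≤k (ℕ.n≤1+n k)) k<|B|
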